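{- Let $b\ge 2$ and $m\ge 0$ be integers. The box-selection procedure described in the context, in dimension $2$ with base $b$ and resolution $m$, terminates after at most $b^m$ steps, i.e. it chooses at most $b^m$ boxes.
   Context: An elementary $b$-adic interval in $[0,1)^s$ is a set $\prod_{j=1}^s\left[\frac{a_j}{b^{d_j}},\frac{a_j+1}{b^{d_j}}\right)$ with $d_j\in\mathbb{N}_0$ and $a_j\in\{0,1,\dots,b^{d_j}-1\}$. A grid box of resolution $m$ is a set $X=\prod_{j=1}^s\left[\frac{u_j}{b^m},\frac{u_j+1}{b^m}\right)$ with $u_j\in\{0,\dots,b^m-1\}$. For such $X$, $\mathcal{E}_m(X)$ denotes the set of all elementary $b$-adic intervals of volume $b^{ -m}$ containing $X$. The procedure (dimension $s$, here $s=2$): set $\mathcal{U}_1=[0,1)^s$ and $n=1$. While $\mathcal{U}_n\neq\emptyset$: choose an arbitrary grid box $X_n$ of resolution $m$ with $X_n\subseteq\mathcal{U}_n$, set $\mathcal{U}_{n+1}=\mathcal{U}_n\setminus\bigcup_{E\in\mathcal{E}_m(X_n)}E$, and increase $n$ by one. The output is the list of chosen boxes; the number of steps is the number of boxes chosen. -}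

module Defs where

open import Data.Nat using (ℕ; suc; _+_; _*_; _^_; _≤_)
open import Data.Fin using (Fin; toℕ)
open import Data.Product using (_×_; _,_)
open import Relation.Binary.PropositionalEquality using (_≡_)
open import Data.Sum using (_⊎_)
open import Data.List using (List; []; _∷_)
open import Data.List.Relation.Unary.All using (All)
open import Data.Unit using (⊤)

-- A grid box of resolution m:  [u₁/b^m,(u₁+1)/b^m) × [u₂/b^m,(u₂+1)/b^m)
-- with u₁,u₂ ∈ {0,…,b^m-1}, represented by the pair (u₁ , u₂).
Box : ℕ → ℕ → Set
Box b m = Fin (b ^ m) × Fin (b ^ m)

-- An elementary b-adic interval in [0,1)^2:
--   [a₁/b^d₁,(a₁+1)/b^d₁) × [a₂/b^d₂,(a₂+1)/b^d₂),  a_j ∈ {0,…,b^d_j - 1}.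
record ElemInt (b : ℕ) : Set where
  constructor elem
  field
    d₁ d₂ : ℕ
    a₁ : Fin (b ^ d₁)
    a₂ : Fin (b ^ d₂)
open ElemInt public

-- Volume of an elementary interval equals b^{-m}  ⇔  d₁ + d₂ = m.
HasVolume : ∀ {b} → ℕ → ElemInt b → Set
HasVolume m E = d₁ E + d₂ E ≡ m

-- One-dimensional facts, with everything multiplied out by b^m · b^d:
-- [u/b^m,(u+1)/b^m) ⊆ [a/b^d,(a+1)/b^d)
--   ⇔ a/b^d ≤ u/b^m  and  (u+1)/b^m ≤ (a+1)/b^d
IntervalSub : ℕ → ℕ → ℕ → ℕ → ℕ → Set
IntervalSub b m u d a = (a * b ^ m ≤ u * b ^ d) × (suc u * b ^ d ≤ suc a * b ^ m)

-- [u/b^m,(u+1)/b^m) ∩ [a/b^d,(a+1)/b^d) = ∅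
--   ⇔ (u+1)/b^m ≤ a/b^d  or  (a+1)/b^d ≤ u/b^m
IntervalDisj : ℕ → ℕ → ℕ → ℕ → ℕ → Set
IntervalDisj b m u d a = (suc u * b ^ d ≤ a * b ^ m) ⊎ (suc a * b ^ m ≤ u * b ^ d)

BoxSub : ∀ {b m} → Box b m → ElemInt b → Set
BoxSub {b} {m} (u₁ , u₂) E =
  IntervalSub b m (toℕ u₁) (d₁ E) (toℕ (a₁ E)) × IntervalSub b m (toℕ u₂) (d₂ E) (toℕ (a₂ E))

-- X ∩ E = ∅ (a product of intervals is disjoint from another iff some coordinate is).
BoxDisj : ∀ {b m} → Box b m → ElemInt b → Set
BoxDisj {b} {m} (u₁ , u₂) E =
  IntervalDisj b m (toℕ u₁) (d₁ E) (toℕ (a₁ E)) ⊎ IntervalDisj b m (toℕ u₂) (d₂ E) (toℕ (a₂ E))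

-- E ∈ 𝓔_m(X): E elementary of volume b^{-m} containing X.
InEm : ∀ {b m} → Box b m → ElemInt b → Set
InEm {b} {m} X E = HasVolume m E × BoxSub {b} {m} X E

-- Y avoids every E ∈ 𝓔_m(X), i.e. Y ∩ ⋃_{E ∈ 𝓔_m(X)} E = ∅.
Avoids : ∀ {b m} → Box b m → Box b m → Set
Avoids {b} {m} X Y = (E : ElemInt b) → InEm {b} {m} X E → BoxDisj {b} {m} Y E

-- A list X₁, X₂, …, X_N (in order of choice) is a possible run of the
-- procedure: each X_n ⊆ 𝓤_n = [0,1)^2 ∖ ⋃_{k<n} ⋃_{E ∈ 𝓔_m(X_k)} E.
ValidRun : ∀ {b m} → List (Box b m) → Set
ValidRun [] = ⊤
ValidRun {b} {m} (X ∷ Xs) = All (Avoids {b} {m} X) Xs × ValidRun {b} {m} Xs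

module Submission where

-- Let p = b^m.  For a grid box X = (u , v) consider the column
-- C(u) = [u/p,(u+1)/p) × [0,1): an elementary interval of volume 1/p that
-- contains X, hence C(u) ∈ 𝓔_m(X).  After X is chosen, every later box must
-- be disjoint from C(u), so its first coordinate differs from u.  Thus the
-- first coordinates of the chosen boxes are pairwise distinct elements of
-- Fin p, and a duplicate-free list over Fin p has length at most p.

open import Defs
open import Data.Nat using (ℕ; _≤_; _^_)
open import Data.List using (List; length)

open import Data.Nat using (suc; _*_; _<_; z≤n; s≤s)
open import Data.Nat.Properties using (≤-refl; ≤-trans; <⇒≱; m<n+m; *-identityʳ; +-identityʳ)
open import Data.Fin as Fin using (Fin; toℕ)
open import Data.Fin.Properties using (toℕ<n; injective⇒≤)
open import Data.List using ([]; _∷_; map; lookup)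
open import Data.List.Properties using (length-map)
open import Data.List.Membership.Propositional.Properties using (∈-lookup)
import Data.List.Relation.Unary.All as All
open import Data.List.Relation.Unary.AllPairs as AllPairs using (AllPairs; []; _∷_)
open import Data.List.Relation.Unary.AllPairs.Properties using (map⁺)
open import Data.List.Relation.Unary.Unique.Propositional using (Unique)
open import Data.Product using (_,_; proj₁)
open import Data.Sum using (inj₁; inj₂; reduce)
open import Data.Empty using (⊥-elim)
open import Relation.Nullary using (¬_)
open import Relation.Binary.PropositionalEquality using (_≡_; _≢_; refl; sym; cong; subst; subst₂)

lookup-injective : ∀ {A : Set} {xs : List A} → Unique xs →
                   ∀ i j → lookup xs i ≡ lookup xs j → i ≡ j
lookup-injective (_ ∷ _) Fin.zero Fin.zero _ = refl
lookup-injective (x≢xs ∷ _) Fin.zero (Fin.suc j) eq =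
  ⊥-elim (All.lookup x≢xs (∈-lookup j) eq)
lookup-injective (x≢xs ∷ _) (Fin.suc i) Fin.zero eq =
  ⊥-elim (All.lookup x≢xs (∈-lookup i) (sym eq))
lookup-injective (_ ∷ xs!) (Fin.suc i) (Fin.suc j) eq =
  cong Fin.suc (lookup-injective xs! i j eq)

unique-length≤ : ∀ {n} {xs : List (Fin n)} → Unique xs → length xs ≤ n
unique-length≤ xs! = injective⇒≤ (λ {i} {j} → lookup-injective xs! i j)

-- With p = b^m, a grid interval [u/p,(u+1)/p) is not disjoint from itself:
-- both disjuncts of IntervalDisj say (u+1)·p ≤ u·p, false since p > u ≥ 0.
grid-meets-itself : ∀ b m (u : Fin (b ^ m)) → ¬ IntervalDisj b m (toℕ u) m (toℕ u)
grid-meets-itself b m u disj = <⇒≱ (m<n+m (toℕ u * b ^ m) p>0) (reduce disj)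
  where
    p>0 : 0 < b ^ m
    p>0 = ≤-trans (s≤s z≤n) (toℕ<n u)

-- A grid interval [v/b^m,(v+1)/b^m) is not disjoint from [0,1) = [0/b^0,1/b^0).
grid-meets-unit : ∀ b m (v : Fin (b ^ m)) → ¬ IntervalDisj b m (toℕ v) 0 0
grid-meets-unit b m v (inj₁ ())
grid-meets-unit b m v (inj₂ le) =
  <⇒≱ (toℕ<n v) (subst₂ _≤_ (+-identityʳ (b ^ m)) (*-identityʳ (toℕ v)) le)

-- The column C(u) = [u/b^m,(u+1)/b^m) × [0,1), an elementary interval of volume b^{-m}.
column : ∀ b m → Fin (b ^ m) → ElemInt b
column b m u = elem m 0 u Fin.zero

column-∈𝓔 : ∀ {b m} (X : Box b m) → InEm {b} {m} X (column b m (proj₁ X))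
column-∈𝓔 {b} {m} (u , v) = +-identityʳ m , (≤-refl , ≤-refl) , (z≤n , fits-in-unit)
  where
    fits-in-unit : suc (toℕ v) * 1 ≤ 1 * b ^ m
    fits-in-unit = subst₂ _≤_ (sym (*-identityʳ (suc (toℕ v)))) (sym (+-identityʳ (b ^ m))) (toℕ<n v)

meets-own-column : ∀ {b m} (Y : Box b m) → ¬ BoxDisj {b} {m} Y (column b m (proj₁ Y))
meets-own-column {b} {m} (u , w) (inj₁ disj) = grid-meets-itself b m u disj
meets-own-column {b} {m} (u , w) (inj₂ disj) = grid-meets-unit b m w disj

-- A box avoiding 𝓔_m(X) misses the column of X, so it lies in another column.
avoids⇒new-column : ∀ {b m} (X Y : Box b m) → Avoids {b} {m} X Y → proj₁ X ≢ proj₁ Y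
avoids⇒new-column {b} {m} X Y avoid same-column =
  meets-own-column {b} {m} Y (subst (λ u → BoxDisj {b} {m} Y (column b m u)) same-column
                                     (avoid (column b m (proj₁ X)) (column-∈𝓔 X)))

validRun⇒allPairs : ∀ {b m} {Xs : List (Box b m)} → ValidRun {b} {m} Xs → AllPairs (Avoids {b} {m}) Xs
validRun⇒allPairs {Xs = []} _ = []
validRun⇒allPairs {Xs = _ ∷ _} (avoided , run) = avoided ∷ validRun⇒allPairs run

columns-unique : ∀ {b m} {Xs : List (Box b m)} → ValidRun {b} {m} Xs → Unique (map proj₁ Xs)
columns-unique run = map⁺ (AllPairs.map (λ {X} {Y} → avoids⇒new-column X Y) (validRun⇒allPairs run))

-- There are b^m columns, each used at most once.
lemma1 : (b m : ℕ) → 2 ≤ b → (Xs : List (Box b m)) → ValidRun {b} {m} Xs → length Xs ≤ b ^ m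
lemma1 b m _ Xs run = subst (_≤ b ^ m) (length-map proj₁ Xs) (unique-length≤ (columns-unique run))
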